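{- For every NNP program $P$, the normal programs $\mathrm{NN}_1(P)$ and $\mathrm{NN}(P)$ are strongly equivalent.
   Context: Atoms $\mathcal{A}$; literals $\mathcal{L}=\mathcal{A}\cup\{\neg a\}$; default literals $\mathit{not}\,\ell$; elementary expressions $\mathcal{E}^1=\mathcal{L}\cup\{\mathit{not}\,\ell\}\cup\{\top,\bot\}$; overlined elementary expressions $\overline{x}$ ($x\in\mathcal{E}^1$). Expressions are built with $\bigwedge[\ldots]$, $\bigvee(\ldots)$; body expressions contain no overlines. Interpretation: $I\subseteq\mathcal{L}$ without complementary pair; $I\models\top$, $I\not\models\bot$, $I\models\ell$ iff $\ell\in I$, $I\models\mathit{not}\,\ell$ iff $\ell\notin I$, $I\models\overline{x}$ iff $I\not\models x$, connectives as usual; $I=\!\!\!|\,\varphi$ means $I\not\models\varphi$. Reduct: $x^I=x$ for $x\in\mathcal{L}\cup\{\top,\bot\}$, $(\mathit{not}\,\ell)^I=\bot$ if $\ell\in I$ else $\top$, $(\overline{x})^I=\overline{x^I}$, commuting with connectives. Positive elements: $\mathcal{L}\cup\{\bot\}$. $\mathcal{N}$: expressions all of whose elementary occurrences are overlined. $\mathcal{H}^+$: smallest set containing $\mathcal{L}\cup\{\bot\}$, closed under $\bigwedge$ of members, and containing $\bigvee(\varphi_1\ldots\varphi_k)$ whenever one $\varphi_i\in\mathcal{H}^+$ and all other $\varphi_j\in\mathcal{N}$. For $H\in\mathcal{H}^+$ and a positive occurrence $h$ (non-overlined occurrence of a positive element), $\Delta(H,h)$: $\bot$ if $H$ is that occurrence;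 $\Delta(H_i,h)$ if $H=\bigwedge[H_1\ldots H_k]$ with the occurrence in $H_i$; $\bigvee(H_1\ldots H_{i-1}\ \Delta(H_i,h)\ H_{i+1}\ldots H_k)$ if $H=\bigvee(H_1\ldots H_k)$ with the occurrence in $H_i$. With $h_1,\ldots,h_k$ all positive occurrences, $H_\Delta=\bigwedge[\bigvee(h_1\,\Delta(H,h_1))\ldots\bigvee(h_k\,\Delta(H,h_k))]$. An NNP program is a finite nonempty set of rules $H\leftarrow B$ with $B$ a body expression and $H\in\mathcal{H}^+$. For an expression $\Delta$ built from overlined elementary expressions and plain $\bot$, its dual $\Delta_B$ is obtained by exchanging $\bigwedge$ and $\bigvee$, replacing each $\overline{x}$ by $x$ and each plain $\bot$ by $\top$, so that $I\models\Delta_B$ iff $I=\!\!\!|\,\Delta$. $\mathrm{dnf}(\psi)$ (resp. $\mathrm{cnf}(\psi)$) is the DNF (resp. CNF) obtained by repeatedly applying distributivity. $N(H\leftarrow B)=\{h\leftarrow C:\ \bigvee(h\,\Delta)\text{ a conjunct of }H_\Delta,\ C\text{ a disjunct of }\mathrm{dnf}(\bigwedge[B\ \Delta_B])\}$, $\mathrm{NN}(P)=\bigcup_{r\in P}N(r)$. Each clause of $\mathrm{cnf}(H)$, $H\in\mathcal{H}^+$, has the form $\bigvee(h\ \overline{y_1}\ldots\overline{y_m})$ with $h$ positive; $\mathrm{NN}_1(P)$ consists of, for each rule $H\leftarrow B\in P$, each such clause of $\mathrm{cnf}(H)$ and each disjunct $C$ of $\mathrm{dnf}(B)$, the rule $h\leftarrow\bigwedge[C\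 y_1\ldots y_m]$. Nested rule $F\leftarrow G$ ($F,G$ expressions); $P^I=\{F^I\leftarrow G^I\}$; $I$ closed under $P^I$ if $I\models F^I$ whenever $I\models G^I$; $I$ answer set of $P$ if $I$ is $\subseteq$-minimal among interpretations closed under $P^I$. $P_1,P_2$ strongly equivalent if for every nested program $Q$, $P_1\cup Q$ and $P_2\cup Q$ have the same answer sets. -}

module Defs where

open import Data.Bool using (Bool; true; false; not; _∧_; _∨_; if_then_else_)
open import Data.List using (List; []; _∷_; _++_; map; concatMap; [_])
open import Data.List.Membership.Propositional using (_∈_)
open import Data.List.Relation.Unary.All using (All)
open import Data.Product using (_×_; _,_; proj₁; proj₂)
open import Relation.Binary.PropositionalEquality using (_≡_)
open import Data.Empty using (⊥)

data Lit (A : Set) : Set where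
  pos : A → Lit A
  neg : A → Lit A        -- classical negation ¬a

data E1 (A : Set) : Set where
  lit  : Lit A → E1 A
  dnot : Lit A → E1 A
  top  : E1 A
  bot  : E1 A

data Expr (A : Set) : Set where
  el  : E1 A → Expr A
  ov  : E1 A → Expr A
  and : List (Expr A) → Expr A
  or  : List (Expr A) → Expr A

record Rule (A : Set) : Set where
  constructor _⟵_
  field
    head : Expr A
    body : Expr A
open Rule public

-- (nested) programs: finite sets of rules, represented as lists
Program : Set → Set
Program A = List (Rule A)

-- Semantics: an interpretation is (the characteristic function of) a
-- set of literals; consistency = no complementary pair.

Interp : Set → Set
Interp A = Lit A → Bool

Consistent : {A : Set} → Interp A → Set
Consistent {A} I = (a : A) → I (pos a) ≡ true → I (neg a) ≡ true → ⊥

_⊆_ : {A : Set} → Interp A → Interp A → Set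
_⊆_ {A} J I = (l : Lit A) → J l ≡ true → I l ≡ true

satE : {A : Set} → Interp A → E1 A → Bool
satE I (lit l)  = I l
satE I (dnot l) = not (I l)
satE I top      = true
satE I bot      = false

mutual
  sat : {A : Set} → Interp A → Expr A → Bool
  sat I (el x)  = satE I x
  sat I (ov x)  = not (satE I x)
  sat I (and φs) = satAll I φs
  sat I (or φs)  = satAny I φs

  satAll : {A : Set} → Interp A → List (Expr A) → Bool
  satAll I []       = true
  satAll I (φ ∷ φs) = sat I φ ∧ satAll I φs

  satAny : {A : Set} → Interp A → List (Expr A) → Bool
  satAny I []       = false
  satAny I (φ ∷ φs) = sat I φ ∨ satAny I φs

_⊨_ : {A : Set} → Interp A → Expr A → Set
I ⊨ φ = sat I φ ≡ true

redE : {A : Set} → Interp A → E1 A → E1 A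
redE I (dnot l) = if I l then bot else top
redE I x        = x

mutual
  red : {A : Set} → Interp A → Expr A → Expr A
  red I (el x)   = el (redE I x)
  red I (ov x)   = ov (redE I x)
  red I (and φs) = and (redL I φs)
  red I (or φs)  = or (redL I φs)

  redL : {A : Set} → Interp A → List (Expr A) → List (Expr A)
  redL I []       = []
  redL I (φ ∷ φs) = red I φ ∷ redL I φs

reductRule : {A : Set} → Interp A → Rule A → Rule A
reductRule I (F ⟵ G) = red I F ⟵ red I G

reduct : {A : Set} → Program A → Interp A → Program A
reduct P I = map (reductRule I) P

Closed : {A : Set} → Program A → Interp A → Set
Closed P J = ∀ r → r ∈ P → J ⊨ body r → J ⊨ head r

AnswerSet : {A : Set} → Program A → Interp A → Set
AnswerSet {A} P I =
  Consistent I × Closed (reduct P I) I ×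
  ((J : Interp A) → Consistent J → J ⊆ I → Closed (reduct P I) J → I ⊆ J)

StronglyEquivalent : {A : Set} → Program A → Program A → Set
StronglyEquivalent {A} P₁ P₂ =
  (Q : Program A) (I : Interp A) →
  (AnswerSet (P₁ ++ Q) I → AnswerSet (P₂ ++ Q) I) ×
  (AnswerSet (P₂ ++ Q) I → AnswerSet (P₁ ++ Q) I)

data NoOverline {A : Set} : Expr A → Set where
  no-el  : ∀ x → NoOverline (el x)
  no-and : ∀ {φs} → All NoOverline φs → NoOverline (and φs)
  no-or  : ∀ {φs} → All NoOverline φs → NoOverline (or φs)

data InN {A : Set} : Expr A → Set where
  n-ov  : ∀ x → InN (ov x)
  n-and : ∀ {φs} → All InN φs → InN (and φs)
  n-or  : ∀ {φs} → All InN φs → InN (or φs)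

data InH {A : Set} : Expr A → Set where
  h-lit : ∀ l → InH (el (lit l))
  h-bot : InH (el bot)
  h-and : ∀ {φs} → All InH φs → InH (and φs)
  h-or  : ∀ pre φ post → All InN pre → InH φ → All InN post →
          InH (or (pre ++ φ ∷ post))

NNPRule : {A : Set} → Rule A → Set
NNPRule r = InH (head r) × NoOverline (body r)

isPos : {A : Set} → E1 A → Bool
isPos (lit _) = true
isPos bot     = true
isPos _       = false

-- list of pairs (h , Δ(H,h)), one for each positive occurrence h of H
mutual
  occs : {A : Set} → Expr A → List (E1 A × Expr A)
  occs (el x)   = if isPos x then [ (x , el bot) ] else []
  occs (ov x)   = []
  occs (and hs) = occsAnd hs
  occs (or hs)  = occsOr [] hs

  occsAnd : {A : Set} → List (Expr A) → List (E1 A × Expr A)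
  occsAnd []       = []
  occsAnd (h ∷ hs) = occs h ++ occsAnd hs

  -- first argument: the disjuncts preceding the current one
  occsOr : {A : Set} → List (Expr A) → List (Expr A) → List (E1 A × Expr A)
  occsOr pre []       = []
  occsOr pre (h ∷ hs) =
    map (λ p → proj₁ p , or (pre ++ proj₂ p ∷ hs)) (occs h)
    ++ occsOr (pre ++ [ h ]) hs

HΔ : {A : Set} → Expr A → Expr A
HΔ H = and (map (λ p → or (el (proj₁ p) ∷ proj₂ p ∷ [])) (occs H))

-- dual Δ_B (only meaningful for expressions built from overlined
-- elementary expressions and plain ⊥; other leaves are left unchanged)
mutual
  dual : {A : Set} → Expr A → Expr A
  dual (el bot)  = el top
  dual (el x)    = el x
  dual (ov x)    = el x
  dual (and φs)  = or (dualL φs)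
  dual (or φs)   = and (dualL φs)

  dualL : {A : Set} → List (Expr A) → List (Expr A)
  dualL []       = []
  dualL (φ ∷ φs) = dual φ ∷ dualL φs

-- DNF / CNF by distributivity: a DNF is a list of disjuncts, each a list
-- of conjuncts (leaves); a CNF is a list of clauses, each a list of
-- disjuncts (leaves).

mutual
  dnf : {A : Set} → Expr A → List (List (Expr A))
  dnf (el x)   = [ [ el x ] ]
  dnf (ov x)   = [ [ ov x ] ]
  dnf (and φs) = dnfAnd φs
  dnf (or φs)  = dnfOr φs

  dnfAnd : {A : Set} → List (Expr A) → List (List (Expr A))
  dnfAnd []       = [ [] ]
  dnfAnd (φ ∷ φs) = prod (dnf φ) (dnfAnd φs)

  dnfOr : {A : Set} → List (Expr A) → List (List (Expr A))
  dnfOr []       = []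
  dnfOr (φ ∷ φs) = dnf φ ++ dnfOr φs

  prod : {A : Set} → List (List (Expr A)) → List (List (Expr A)) → List (List (Expr A))
  prod xs ys = concatMap (λ c → map (c ++_) ys) xs

mutual
  cnf : {A : Set} → Expr A → List (List (Expr A))
  cnf (el x)   = [ [ el x ] ]
  cnf (ov x)   = [ [ ov x ] ]
  cnf (and φs) = cnfAnd φs
  cnf (or φs)  = cnfOr φs

  cnfAnd : {A : Set} → List (Expr A) → List (List (Expr A))
  cnfAnd []       = []
  cnfAnd (φ ∷ φs) = cnf φ ++ cnfAnd φs

  cnfOr : {A : Set} → List (Expr A) → List (List (Expr A))
  cnfOr []       = [ [] ]
  cnfOr (φ ∷ φs) = prod (cnf φ) (cnfOr φs)

Nrule : {A : Set} → Rule A → Program A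
Nrule (H ⟵ B) =
  concatMap (λ p → map (λ C → el (proj₁ p) ⟵ and C)
                       (dnf (and (B ∷ dual (proj₂ p) ∷ []))))
            (occs H)

NN : {A : Set} → Program A → Program A
NN P = concatMap Nrule P

-- split a clause ⋁(h ȳ₁ … ȳ_m) into its non-overlined members and the y's
splitClause : {A : Set} → List (Expr A) → List (Expr A) × List (E1 A)
splitClause []          = [] , []
splitClause (ov y ∷ es) = proj₁ (splitClause es) , y ∷ proj₂ (splitClause es)
splitClause (e ∷ es)    = e ∷ proj₁ (splitClause es) , proj₂ (splitClause es)

-- head of the rule built from a clause: the unique non-overlined member h
-- (for H ∈ ℋ⁺ there is exactly one; otherwise the disjunction of them)
clauseHead : {A : Set} → List (Expr A) → Expr A
clauseHead (e ∷ []) = e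
clauseHead es       = or es

N1rule : {A : Set} → Rule A → Program A
N1rule (H ⟵ B) =
  concatMap (λ cl → map (λ C → clauseHead (proj₁ (splitClause cl))
                               ⟵ and (and C ∷ map el (proj₂ (splitClause cl))))
                        (dnf B))
            (cnf H)

NN₁ : {A : Set} → Program A → Program A
NN₁ P = concatMap N1rule P

{-# OPTIONS --safe #-}

-- Evaluating the reduct of φ relative to I in J is classical evaluation of φ under the
-- valuation x ↦ satE J (redE I x), in which every elementary expression, default
-- literals included, is an independent propositional variable.  So programs whose rules
-- are equivalent under all such valuations have, for every I and every added program Q,
-- reducts with the same closed interpretations, hence the same answer sets.  Both NN₁(P)
-- and NN(P) are classically equivalent to P: NN₁ splits H ← B along the clauses of cnf H
-- (moving their overlined members into the body as positive conditions) and the disjuncts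
-- of dnf B; NN splits it along the conjuncts ⋁(h Δ(H,h)) of H_Δ, which is equivalent to H
-- for H ∈ ℋ⁺, and the disjuncts of dnf ⋀[B Δ_B].

module Submission where

open import Defs
open import Algebra.Core using (Op₂)
open import Algebra.Structures using (IsMonoid; IsSemiring)
open import Data.Bool using (Bool; true; false; not; _∧_; _∨_)
open import Data.Bool.Properties
  using ( ∨-∧-isSemiring; ∧-∨-isSemiring; ∨-∧-booleanAlgebra; ∧-identityʳ; ∨-identityʳ
        ; ∧-assoc; ∨-assoc; ∨-comm; ∨-zeroʳ; ∧-zeroʳ; not-involutive; ∧-conicalˡ; ∧-conicalʳ )
open import Algebra.Lattice.Properties.BooleanAlgebra ∨-∧-booleanAlgebra using (deMorgan₁; deMorgan₂)
open import Data.Bool.ListAction using (all; any)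
open import Data.List using (List; []; _∷_; _++_; [_]; map; concatMap; foldr)
open import Data.List.Properties using (map-∘; map-cong; ++-identityʳ; ++-assoc)
open import Data.List.Relation.Unary.All as All using (All; []; _∷_)
open import Data.List.Relation.Unary.Any using (here; there)
open import Data.Product using (_×_; _,_; proj₁; proj₂)
open import Function using (_∘_; _⟨_⟩_; _⇔_; mk⇔; Equivalence)
import Function.Properties.Equivalence as ⇔
open import Relation.Binary.PropositionalEquality
  using (_≡_; _≢_; _≗_; refl; sym; trans; cong; cong₂; module ≡-Reasoning)

module MonoidSums {C : Set} {_+_ : Op₂ C} {0# : C} (isMonoid : IsMonoid _≡_ _+_ 0#) where
  open IsMonoid isMonoid using (assoc; identityˡ)

  sum : {X : Set} → (X → C) → List X → C
  sum g xs = foldr _+_ 0# (map g xs)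

  sum-++ : ∀ {X} (g : X → C) xs ys → sum g (xs ++ ys) ≡ sum g xs + sum g ys
  sum-++ g []       ys = sym (identityˡ _)
  sum-++ g (x ∷ xs) ys = trans (cong (g x +_) (sum-++ g xs ys)) (sym (assoc _ _ _))

  sum-concatMap : ∀ {X Y} (g : Y → C) (h : X → List Y) xs →
                  sum g (concatMap h xs) ≡ sum (sum g ∘ h) xs
  sum-concatMap g h []       = refl
  sum-concatMap g h (x ∷ xs) =
    trans (sum-++ g (h x) _) (cong (sum g (h x) +_) (sum-concatMap g h xs))

  sum-map : ∀ {X Y} (g : Y → C) (h : X → Y) xs → sum g (map h xs) ≡ sum (g ∘ h) xs
  sum-map g h xs = cong (foldr _+_ 0#) (sym (map-∘ xs))

  sum-cong : ∀ {X} {g h : X → C} → g ≗ h → sum g ≗ sum h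
  sum-cong g≗h xs = cong (foldr _+_ 0#) (map-cong g≗h xs)

module SemiringSums {C : Set} {_+_ _*_ : Op₂ C} {0# 1# : C}
                    (isSemiring : IsSemiring _≡_ _+_ _*_ 0# 1#) where
  open IsSemiring isSemiring using (+-isMonoid; distribˡ; distribʳ; zeroˡ; zeroʳ)
  open MonoidSums +-isMonoid public
  open ≡-Reasoning

  sum-*ˡ : ∀ {X} a (g : X → C) xs → sum (λ x → a * g x) xs ≡ a * sum g xs
  sum-*ˡ a g []       = sym (zeroʳ a)
  sum-*ˡ a g (x ∷ xs) = trans (cong ((a * g x) +_) (sum-*ˡ a g xs)) (sym (distribˡ a _ _))

  sum-*ʳ : ∀ {X} (g : X → C) a xs → sum (λ x → g x * a) xs ≡ sum g xs * a
  sum-*ʳ g a []       = sym (zeroˡ a)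
  sum-*ʳ g a (x ∷ xs) = trans (cong ((g x * a) +_) (sum-*ʳ g a xs)) (sym (distribʳ a _ _))

  sum-prod : ∀ {A} (m : List (Expr A) → C) → (∀ c d → m (c ++ d) ≡ m c * m d) →
             ∀ xs ys → sum m (prod xs ys) ≡ sum m xs * sum m ys
  sum-prod m m-++ xs ys = begin
    sum m (prod xs ys)                      ≡⟨ sum-concatMap m (λ c → map (c ++_) ys) xs ⟩
    sum (λ c → sum m (map (c ++_) ys)) xs   ≡⟨ sum-cong (λ c → sum-map m (c ++_) ys) xs ⟩
    sum (λ c → sum (m ∘ (c ++_)) ys) xs     ≡⟨ sum-cong (λ c → sum-cong (m-++ c) ys) xs ⟩
    sum (λ c → sum (λ d → m c * m d) ys) xs ≡⟨ sum-cong (λ c → sum-*ˡ (m c) m ys) xs ⟩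
    sum (λ c → m c * sum m ys) xs           ≡⟨ sum-*ʳ m (sum m ys) xs ⟩
    sum m xs * sum m ys                     ∎

-- In the semiring (∨, ∧) `sum` is `any`; in (∧, ∨) it is `all`.
open SemiringSums ∨-∧-isSemiring using ()
  renaming (sum-++ to any-++; sum-*ʳ to any-∧ʳ; sum-prod to any-prod)
open SemiringSums ∧-∨-isSemiring using ()
  renaming (sum-++ to all-++; sum-concatMap to all-concatMap; sum-map to all-map;
            sum-cong to all-cong; sum-*ˡ to all-∨ˡ; sum-*ʳ to all-∨ʳ; sum-prod to all-prod)

all-not : ∀ {X : Set} (g : X → Bool) xs → all (not ∘ g) xs ≡ not (any g xs)
all-not g []       = refl
all-not g (x ∷ xs) = trans (cong (not (g x) ∧_) (all-not g xs)) (sym (deMorgan₂ (g x) (any g xs)))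

exportation : ∀ a b c → not (a ∧ b) ∨ c ≡ not a ∨ (c ∨ not b)
exportation true  true  c = sym (∨-identityʳ c)
exportation true  false c = sym (∨-zeroʳ c)
exportation false b     c = refl

Valuation : Set → Set
Valuation A = E1 A → Bool

mutual
  eval : {A : Set} → Valuation A → Expr A → Bool
  eval f (el x)   = f x
  eval f (ov x)   = not (f x)
  eval f (and φs) = evalAll f φs
  eval f (or φs)  = evalAny f φs

  evalAll : {A : Set} → Valuation A → List (Expr A) → Bool
  evalAll f []       = true
  evalAll f (φ ∷ φs) = eval f φ ∧ evalAll f φs

  evalAny : {A : Set} → Valuation A → List (Expr A) → Bool
  evalAny f []       = false
  evalAny f (φ ∷ φs) = eval f φ ∨ evalAny f φs

holds : {A : Set} → Valuation A → Rule A → Bool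
holds f r = not (eval f (body r)) ∨ eval f (head r)

reductValuation : {A : Set} → Interp A → Interp A → Valuation A
reductValuation I J x = satE J (redE I x)

module _ {A : Set} (I J : Interp A) where

  mutual
    sat-red : ∀ φ → sat J (red I φ) ≡ eval (reductValuation I J) φ
    sat-red (el x)   = refl
    sat-red (ov x)   = refl
    sat-red (and φs) = satAll-redL φs
    sat-red (or φs)  = satAny-redL φs

    satAll-redL : ∀ φs → satAll J (redL I φs) ≡ evalAll (reductValuation I J) φs
    satAll-redL []       = refl
    satAll-redL (φ ∷ φs) = cong₂ _∧_ (sat-red φ) (satAll-redL φs)

    satAny-redL : ∀ φs → satAny J (redL I φs) ≡ evalAny (reductValuation I J) φs
    satAny-redL []       = refl
    satAny-redL (φ ∷ φs) = cong₂ _∨_ (sat-red φ) (satAny-redL φs)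

  private
    f = reductValuation I J

  closed⇒all-holds : ∀ X → Closed (reduct X I) J → all (holds f) X ≡ true
  closed⇒all-holds []      _      = refl
  closed⇒all-holds (r ∷ X) closed =
    cong₂ _∧_ (implication-intro (λ b → trans (sym (sat-red (head r)))
                                     (closed _ (here refl) (trans (sat-red (body r)) b))))
              (closed⇒all-holds X (λ r′ → closed r′ ∘ there))
    where
    implication-intro : ∀ {a b} → (a ≡ true → b ≡ true) → not a ∨ b ≡ true
    implication-intro {false} _   = refl
    implication-intro {true}  a→b = a→b refl

  all-holds⇒closed : ∀ X → all (holds f) X ≡ true → Closed (reduct X I) J
  all-holds⇒closed []      _         _ ()
  all-holds⇒closed (r ∷ X) holds-all _ (here refl) J⊨body =
    trans (sat-red (head r))
          (implication-elim (∧-conicalˡ _ _ holds-all) (trans (sym (sat-red (body r))) J⊨body))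
    where
    implication-elim : ∀ {a b} → not a ∨ b ≡ true → a ≡ true → b ≡ true
    implication-elim a⇒b refl = a⇒b
  all-holds⇒closed (r ∷ X) holds-all r′ (there r′∈X) =
    all-holds⇒closed X (∧-conicalʳ _ _ holds-all) r′ r′∈X

  closed⇔all-holds : ∀ X → Closed (reduct X I) J ⇔ (all (holds f) X ≡ true)
  closed⇔all-holds X = mk⇔ (closed⇒all-holds X) (all-holds⇒closed X)

answerSet-transfer : {A : Set} {X Y : Program A} {I : Interp A} →
                     (∀ J → Closed (reduct X I) J ⇔ Closed (reduct Y I) J) →
                     AnswerSet X I → AnswerSet Y I
answerSet-transfer {I = I} closed⇔ (consistent , closed , minimal) =
  consistent , Equivalence.to (closed⇔ I) closed ,
  λ J J-consistent J⊆I J-closed → minimal J J-consistent J⊆I (Equivalence.from (closed⇔ J) J-closed)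

-- Only ⊤ needs a fixed value: it is the dual Δ_B of the ⊥ that Δ(H,h) puts at h.
ClassicallyEquivalent : {A : Set} → Program A → Program A → Set
ClassicallyEquivalent {A} X Y =
  (f : Valuation A) → f top ≡ true → all (holds f) X ≡ all (holds f) Y

classicallyEquivalent⇒stronglyEquivalent : {A : Set} {X Y : Program A} →
  ClassicallyEquivalent X Y → StronglyEquivalent X Y
classicallyEquivalent⇒stronglyEquivalent {X = X} {Y} X≈Y Q I =
  answerSet-transfer closed⇔ , answerSet-transfer (⇔.sym ∘ closed⇔)
  where
  closed⇔ : ∀ J → Closed (reduct (X ++ Q) I) J ⇔ Closed (reduct (Y ++ Q) I) J
  closed⇔ J = closed⇔all-holds I J (X ++ Q)
                ⟨ ⇔.trans ⟩ mk⇔ (trans (sym same)) (trans same)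
                ⟨ ⇔.trans ⟩ ⇔.sym (closed⇔all-holds I J (Y ++ Q))
    where
    f = reductValuation I J
    same : all (holds f) (X ++ Q) ≡ all (holds f) (Y ++ Q)
    same = trans (all-++ (holds f) X Q)
                 (trans (cong (_∧ all (holds f) Q) (X≈Y f refl)) (sym (all-++ (holds f) Y Q)))

module _ {A : Set} where

  occsOr-skip : ∀ pre (φ : Expr A) φs → occs φ ≡ [] → occsOr pre (φ ∷ φs) ≡ occsOr (pre ++ [ φ ]) φs
  occsOr-skip pre φ φs no-occs rewrite no-occs = refl

  mutual
    occs-InN : {ψ : Expr A} → InN ψ → occs ψ ≡ []
    occs-InN (n-ov x)   = refl
    occs-InN (n-and Ns) = occsAnd-InN Ns
    occs-InN (n-or Ns)  = occsOr-InN [] Ns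

    occsAnd-InN : {φs : List (Expr A)} → All InN φs → occsAnd φs ≡ []
    occsAnd-InN []       = refl
    occsAnd-InN (N ∷ Ns) = trans (cong (_++ _) (occs-InN N)) (occsAnd-InN Ns)

    occsOr-InN : ∀ (pre : List (Expr A)) {φs : List (Expr A)} → All InN φs → occsOr pre φs ≡ []
    occsOr-InN pre []                  = refl
    occsOr-InN pre {φ ∷ φs} (N ∷ Ns) =
      trans (occsOr-skip pre φ φs (occs-InN N)) (occsOr-InN (pre ++ [ φ ]) Ns)

  occsOr-skip-InN : ∀ (pre : List (Expr A)) {skipped} rest → All InN skipped →
                    occsOr pre (skipped ++ rest) ≡ occsOr (pre ++ skipped) rest
  occsOr-skip-InN pre rest []       = cong (λ pre′ → occsOr pre′ rest) (sym (++-identityʳ pre))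
  occsOr-skip-InN pre {φ ∷ φs} rest (N ∷ Ns) = begin
    occsOr pre (φ ∷ φs ++ rest)          ≡⟨ occsOr-skip pre φ (φs ++ rest) (occs-InN N) ⟩
    occsOr (pre ++ [ φ ]) (φs ++ rest)   ≡⟨ occsOr-skip-InN (pre ++ [ φ ]) rest Ns ⟩
    occsOr ((pre ++ [ φ ]) ++ φs) rest   ≡⟨ cong (λ pre′ → occsOr pre′ rest) (++-assoc pre [ φ ] φs) ⟩
    occsOr (pre ++ φ ∷ φs) rest          ∎
    where open ≡-Reasoning

  dualL-++ : ∀ (φs ψs : List (Expr A)) → dualL (φs ++ ψs) ≡ dualL φs ++ dualL ψs
  dualL-++ []       ψs = refl
  dualL-++ (φ ∷ φs) ψs = cong (dual φ ∷_) (dualL-++ φs ψs)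

module _ {A : Set} (f : Valuation A) where
  open ≡-Reasoning

  evalAll-++ : ∀ φs ψs → evalAll f (φs ++ ψs) ≡ evalAll f φs ∧ evalAll f ψs
  evalAll-++ []       ψs = refl
  evalAll-++ (φ ∷ φs) ψs =
    trans (cong (eval f φ ∧_) (evalAll-++ φs ψs)) (sym (∧-assoc (eval f φ) (evalAll f φs) _))

  evalAny-++ : ∀ φs ψs → evalAny f (φs ++ ψs) ≡ evalAny f φs ∨ evalAny f ψs
  evalAny-++ []       ψs = refl
  evalAny-++ (φ ∷ φs) ψs =
    trans (cong (eval f φ ∨_) (evalAny-++ φs ψs)) (sym (∨-assoc (eval f φ) (evalAny f φs) _))

  mutual
    eval-dual-InN : {ψ : Expr A} → InN ψ → eval f (dual ψ) ≡ not (eval f ψ)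
    eval-dual-InN (n-ov x)   = sym (not-involutive (f x))
    eval-dual-InN (n-and Ns) = evalAny-dualL-InN Ns
    eval-dual-InN (n-or Ns)  = evalAll-dualL-InN Ns

    evalAny-dualL-InN : {φs : List (Expr A)} → All InN φs → evalAny f (dualL φs) ≡ not (evalAll f φs)
    evalAny-dualL-InN []                = refl
    evalAny-dualL-InN {φ ∷ φs} (N ∷ Ns) =
      trans (cong₂ _∨_ (eval-dual-InN N) (evalAny-dualL-InN Ns)) (sym (deMorgan₁ (eval f φ) (evalAll f φs)))

    evalAll-dualL-InN : {φs : List (Expr A)} → All InN φs → evalAll f (dualL φs) ≡ not (evalAny f φs)
    evalAll-dualL-InN []                = refl
    evalAll-dualL-InN {φ ∷ φs} (N ∷ Ns) =
      trans (cong₂ _∧_ (eval-dual-InN N) (evalAll-dualL-InN Ns)) (sym (deMorgan₂ (eval f φ) (evalAny f φs)))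

  mutual
    any-evalAll-dnf : ∀ φ → any (evalAll f) (dnf φ) ≡ eval f φ
    any-evalAll-dnf (el x)   = trans (∨-identityʳ _) (∧-identityʳ _)
    any-evalAll-dnf (ov x)   = trans (∨-identityʳ _) (∧-identityʳ _)
    any-evalAll-dnf (and φs) = any-evalAll-dnfAnd φs
    any-evalAll-dnf (or φs)  = any-evalAll-dnfOr φs

    any-evalAll-dnfAnd : ∀ φs → any (evalAll f) (dnfAnd φs) ≡ evalAll f φs
    any-evalAll-dnfAnd []       = refl
    any-evalAll-dnfAnd (φ ∷ φs) =
      trans (any-prod (evalAll f) evalAll-++ (dnf φ) (dnfAnd φs))
            (cong₂ _∧_ (any-evalAll-dnf φ) (any-evalAll-dnfAnd φs))

    any-evalAll-dnfOr : ∀ φs → any (evalAll f) (dnfOr φs) ≡ evalAny f φs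
    any-evalAll-dnfOr []       = refl
    any-evalAll-dnfOr (φ ∷ φs) =
      trans (any-++ (evalAll f) (dnf φ) (dnfOr φs))
            (cong₂ _∨_ (any-evalAll-dnf φ) (any-evalAll-dnfOr φs))

  mutual
    all-evalAny-cnf : ∀ φ → all (evalAny f) (cnf φ) ≡ eval f φ
    all-evalAny-cnf (el x)   = trans (∧-identityʳ _) (∨-identityʳ _)
    all-evalAny-cnf (ov x)   = trans (∧-identityʳ _) (∨-identityʳ _)
    all-evalAny-cnf (and φs) = all-evalAny-cnfAnd φs
    all-evalAny-cnf (or φs)  = all-evalAny-cnfOr φs

    all-evalAny-cnfAnd : ∀ φs → all (evalAny f) (cnfAnd φs) ≡ evalAll f φs
    all-evalAny-cnfAnd []       = refl
    all-evalAny-cnfAnd (φ ∷ φs) =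
      trans (all-++ (evalAny f) (cnf φ) (cnfAnd φs))
            (cong₂ _∧_ (all-evalAny-cnf φ) (all-evalAny-cnfAnd φs))

    all-evalAny-cnfOr : ∀ φs → all (evalAny f) (cnfOr φs) ≡ evalAny f φs
    all-evalAny-cnfOr []       = refl
    all-evalAny-cnfOr (φ ∷ φs) =
      trans (all-prod (evalAny f) evalAny-++ (cnf φ) (cnfOr φs))
            (cong₂ _∨_ (all-evalAny-cnf φ) (all-evalAny-cnfOr φs))

  all-holds-map : ∀ {X : Set} (h : Expr A) (b : X → Expr A) xs →
                  all (holds f) (map (λ x → h ⟵ b x) xs) ≡ not (any (eval f ∘ b) xs) ∨ eval f h
  all-holds-map h b xs = begin
    all (holds f) (map (λ x → h ⟵ b x) xs)        ≡⟨ all-map (holds f) (λ x → h ⟵ b x) xs ⟩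
    all (λ x → not (eval f (b x)) ∨ eval f h) xs  ≡⟨ all-∨ʳ (not ∘ eval f ∘ b) (eval f h) xs ⟩
    all (not ∘ eval f ∘ b) xs ∨ eval f h          ≡⟨ cong (_∨ eval f h) (all-not (eval f ∘ b) xs) ⟩
    not (any (eval f ∘ b) xs) ∨ eval f h          ∎

  all-holds-concatMap : ∀ {g : Rule A → Program A} {P} →
                        All (λ r → all (holds f) (g r) ≡ holds f r) P →
                        all (holds f) (concatMap g P) ≡ all (holds f) P
  all-holds-concatMap []                          = refl
  all-holds-concatMap {g} {r ∷ P} (g-r≈r ∷ g-P≈P) =
    trans (all-++ (holds f) (g r) (concatMap g P)) (cong₂ _∧_ g-r≈r (all-holds-concatMap g-P≈P))

  evalAny-splitClause : ∀ cl → evalAny f cl ≡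
    evalAny f (proj₁ (splitClause cl)) ∨ not (evalAll f (map el (proj₂ (splitClause cl))))
  evalAny-splitClause []            = refl
  evalAny-splitClause (ov y ∷ cl)   = begin
    not (f y) ∨ evalAny f cl            ≡⟨ cong (not (f y) ∨_) (evalAny-splitClause cl) ⟩
    not (f y) ∨ (heads ∨ not guard)     ≡⟨ exportation (f y) guard heads ⟨
    not (f y ∧ guard) ∨ heads           ≡⟨ ∨-comm (not (f y ∧ guard)) heads ⟩
    heads ∨ not (f y ∧ guard)           ∎
    where
    heads = evalAny f (proj₁ (splitClause cl))
    guard = evalAll f (map el (proj₂ (splitClause cl)))
  evalAny-splitClause (el x ∷ cl)   =
    trans (cong (f x ∨_) (evalAny-splitClause cl)) (sym (∨-assoc (f x) _ _))
  evalAny-splitClause (and φs ∷ cl) =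
    trans (cong (evalAll f φs ∨_) (evalAny-splitClause cl)) (sym (∨-assoc (evalAll f φs) _ _))
  evalAny-splitClause (or φs ∷ cl)  =
    trans (cong (evalAny f φs ∨_) (evalAny-splitClause cl)) (sym (∨-assoc (evalAny f φs) _ _))

  eval-clauseHead : ∀ es → eval f (clauseHead es) ≡ evalAny f es
  eval-clauseHead []           = refl
  eval-clauseHead (e ∷ [])     = sym (∨-identityʳ (eval f e))
  eval-clauseHead (e ∷ _ ∷ _)  = refl

  all-holds-N1rule : ∀ r → all (holds f) (N1rule r) ≡ holds f r
  all-holds-N1rule (H ⟵ B) = begin
    all (holds f) (N1rule (H ⟵ B))                      ≡⟨ all-concatMap (holds f) clauseRules (cnf H) ⟩
    all (all (holds f) ∘ clauseRules) (cnf H)          ≡⟨ all-cong clauseRules-holds (cnf H) ⟩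
    all (λ cl → not (eval f B) ∨ evalAny f cl) (cnf H) ≡⟨ all-∨ˡ (not (eval f B)) (evalAny f) (cnf H) ⟩
    not (eval f B) ∨ all (evalAny f) (cnf H)           ≡⟨ cong (not (eval f B) ∨_) (all-evalAny-cnf H) ⟩
    holds f (H ⟵ B)                                    ∎
    where
    clauseRules : List (Expr A) → Program A
    clauseRules cl = map (λ C → clauseHead (proj₁ (splitClause cl))
                                ⟵ and (and C ∷ map el (proj₂ (splitClause cl))))
                         (dnf B)

    clauseRules-holds : ∀ cl → all (holds f) (clauseRules cl) ≡ not (eval f B) ∨ evalAny f cl
    clauseRules-holds cl = begin
      all (holds f) (clauseRules cl)
        ≡⟨ all-holds-map (clauseHead hs) (λ C → and (and C ∷ map el ys)) (dnf B) ⟩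
      not (any (λ C → evalAll f C ∧ guard) (dnf B)) ∨ eval f (clauseHead hs)
        ≡⟨ cong (λ b → not b ∨ eval f (clauseHead hs)) body-eval ⟩
      not (eval f B ∧ guard) ∨ eval f (clauseHead hs)
        ≡⟨ exportation (eval f B) guard (eval f (clauseHead hs)) ⟩
      not (eval f B) ∨ (eval f (clauseHead hs) ∨ not guard)
        ≡⟨ cong (λ h → not (eval f B) ∨ (h ∨ not guard)) (eval-clauseHead hs) ⟩
      not (eval f B) ∨ (evalAny f hs ∨ not guard)
        ≡⟨ cong (not (eval f B) ∨_) (evalAny-splitClause cl) ⟨
      not (eval f B) ∨ evalAny f cl
        ∎
      where
      hs = proj₁ (splitClause cl)
      ys = proj₂ (splitClause cl)
      guard = evalAll f (map el ys)
      body-eval : any (λ C → evalAll f C ∧ guard) (dnf B) ≡ eval f B ∧ guard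
      body-eval = trans (any-∧ʳ (evalAll f) guard (dnf B)) (cong (_∧ guard) (any-evalAll-dnf B))

  all-holds-NN₁ : ∀ P → all (holds f) (NN₁ P) ≡ all (holds f) P
  all-holds-NN₁ P = all-holds-concatMap (All.universal all-holds-N1rule P)

module _ {A : Set} (f : Valuation A) (f-top : f top ≡ true) where
  open ≡-Reasoning

  -- The conjunct ⋁(h Δ(H,h)) of H_Δ, with Δ(H,h) evaluated as the negation of its dual.
  occurrenceClause : E1 A × Expr A → Bool
  occurrenceClause (h , Δ) = f h ∨ not (eval f (dual Δ))

  occurrenceClause-or : ∀ {pre post} → All InN pre → All InN post → ∀ h Δ →
    occurrenceClause (h , or (pre ++ Δ ∷ post)) ≡
    (evalAny f pre ∨ evalAny f post) ∨ occurrenceClause (h , Δ)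
  occurrenceClause-or {pre} {post} Npre Npost h Δ = begin
    f h ∨ not (evalAll f (dualL (pre ++ Δ ∷ post)))
      ≡⟨ cong (λ d → f h ∨ not d)
              (trans (cong (evalAll f) (dualL-++ pre (Δ ∷ post))) (evalAll-++ f (dualL pre) _)) ⟩
    f h ∨ not (evalAll f (dualL pre) ∧ (eval f (dual Δ) ∧ evalAll f (dualL post)))
      ≡⟨ cong₂ (λ a c → f h ∨ not (a ∧ (eval f (dual Δ) ∧ c)))
               (evalAll-dualL-InN f Npre) (evalAll-dualL-InN f Npost) ⟩
    f h ∨ not (not (evalAny f pre) ∧ (eval f (dual Δ) ∧ not (evalAny f post)))
      ≡⟨ flatten (f h) (evalAny f pre) (eval f (dual Δ)) (evalAny f post) ⟩
    (evalAny f pre ∨ evalAny f post) ∨ (f h ∨ not (eval f (dual Δ)))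
      ∎
    where
    flatten : ∀ h a d c → h ∨ not (not a ∧ (d ∧ not c)) ≡ (a ∨ c) ∨ (h ∨ not d)
    flatten h true  d     c     = ∨-zeroʳ h
    flatten h false d     true  = trans (cong (λ x → h ∨ not x) (∧-zeroʳ d)) (∨-zeroʳ h)
    flatten h false true  false = refl
    flatten h false false false = refl

  single-occurrence : ∀ x → all occurrenceClause [ (x , el bot) ] ≡ f x
  single-occurrence x = begin
    (f x ∨ not (f top)) ∧ true ≡⟨ ∧-identityʳ _ ⟩
    f x ∨ not (f top)          ≡⟨ cong (λ t → f x ∨ not t) f-top ⟩
    f x ∨ false                ≡⟨ ∨-identityʳ (f x) ⟩
    f x                        ∎

  mutual
    all-occurrenceClause-occs : {H : Expr A} → InH H → all occurrenceClause (occs H) ≡ eval f H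
    all-occurrenceClause-occs (h-lit l)  = single-occurrence (lit l)
    all-occurrenceClause-occs h-bot      = single-occurrence bot
    all-occurrenceClause-occs (h-and Hs) = all-occurrenceClause-occsAnd Hs
    all-occurrenceClause-occs (h-or pre φ post Npre Hφ Npost) = begin
      all occurrenceClause (occsOr [] (pre ++ φ ∷ post))
        ≡⟨ cong (all occurrenceClause) (occsOr-skip-InN [] (φ ∷ post) Npre) ⟩
      all occurrenceClause (map inOr (occs φ) ++ occsOr (pre ++ [ φ ]) post)
        ≡⟨ all-++ occurrenceClause (map inOr (occs φ)) _ ⟩
      all occurrenceClause (map inOr (occs φ)) ∧ all occurrenceClause (occsOr (pre ++ [ φ ]) post)
        ≡⟨ cong₂ _∧_ (all-map occurrenceClause inOr (occs φ))
                     (cong (all occurrenceClause) (occsOr-InN (pre ++ [ φ ]) Npost)) ⟩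
      all (occurrenceClause ∘ inOr) (occs φ) ∧ true
        ≡⟨ ∧-identityʳ _ ⟩
      all (occurrenceClause ∘ inOr) (occs φ)
        ≡⟨ all-cong (λ (h , Δ) → occurrenceClause-or Npre Npost h Δ) (occs φ) ⟩
      all (λ p → others ∨ occurrenceClause p) (occs φ)
        ≡⟨ all-∨ˡ others occurrenceClause (occs φ) ⟩
      others ∨ all occurrenceClause (occs φ)
        ≡⟨ cong (others ∨_) (all-occurrenceClause-occs Hφ) ⟩
      (evalAny f pre ∨ evalAny f post) ∨ eval f φ
        ≡⟨ middle (evalAny f pre) (evalAny f post) (eval f φ) ⟩
      evalAny f pre ∨ (eval f φ ∨ evalAny f post)
        ≡⟨ evalAny-++ f pre (φ ∷ post) ⟨
      evalAny f (pre ++ φ ∷ post)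
        ∎
      where
      inOr : E1 A × Expr A → E1 A × Expr A
      inOr (h , Δ) = h , or (pre ++ Δ ∷ post)
      others = evalAny f pre ∨ evalAny f post
      middle : ∀ a c e → (a ∨ c) ∨ e ≡ a ∨ (e ∨ c)
      middle true  c     e = refl
      middle false true  e = sym (∨-zeroʳ e)
      middle false false e = sym (∨-identityʳ e)

    all-occurrenceClause-occsAnd : {Hs : List (Expr A)} → All InH Hs →
                                   all occurrenceClause (occsAnd Hs) ≡ evalAll f Hs
    all-occurrenceClause-occsAnd []                = refl
    all-occurrenceClause-occsAnd {H ∷ Hs} (H∈ℋ⁺ ∷ Hs∈ℋ⁺) =
      trans (all-++ occurrenceClause (occs H) (occsAnd Hs))
            (cong₂ _∧_ (all-occurrenceClause-occs H∈ℋ⁺) (all-occurrenceClause-occsAnd Hs∈ℋ⁺))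

  all-holds-Nrule : ∀ r → InH (head r) → all (holds f) (Nrule r) ≡ holds f r
  all-holds-Nrule (H ⟵ B) H∈ℋ⁺ = begin
    all (holds f) (Nrule (H ⟵ B))
      ≡⟨ all-concatMap (holds f) occurrenceRules (occs H) ⟩
    all (all (holds f) ∘ occurrenceRules) (occs H)
      ≡⟨ all-cong occurrenceRules-holds (occs H) ⟩
    all (λ p → not (eval f B) ∨ occurrenceClause p) (occs H)
      ≡⟨ all-∨ˡ (not (eval f B)) occurrenceClause (occs H) ⟩
    not (eval f B) ∨ all occurrenceClause (occs H)
      ≡⟨ cong (not (eval f B) ∨_) (all-occurrenceClause-occs H∈ℋ⁺) ⟩
    holds f (H ⟵ B)
      ∎
    where
    occurrenceRules : E1 A × Expr A → Program A
    occurrenceRules (h , Δ) = map (λ C → el h ⟵ and C) (dnf (and (B ∷ dual Δ ∷ [])))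

    occurrenceRules-holds : ∀ p → all (holds f) (occurrenceRules p) ≡ not (eval f B) ∨ occurrenceClause p
    occurrenceRules-holds (h , Δ) = begin
      all (holds f) (occurrenceRules (h , Δ))
        ≡⟨ all-holds-map f (el h) and (dnf (and (B ∷ dual Δ ∷ []))) ⟩
      not (any (evalAll f) (dnf (and (B ∷ dual Δ ∷ [])))) ∨ f h
        ≡⟨ cong (λ b → not b ∨ f h) (any-evalAll-dnf f (and (B ∷ dual Δ ∷ []))) ⟩
      not (eval f B ∧ (eval f (dual Δ) ∧ true)) ∨ f h
        ≡⟨ cong (λ d → not (eval f B ∧ d) ∨ f h) (∧-identityʳ (eval f (dual Δ))) ⟩
      not (eval f B ∧ eval f (dual Δ)) ∨ f h
        ≡⟨ exportation (eval f B) (eval f (dual Δ)) (f h) ⟩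
      not (eval f B) ∨ occurrenceClause (h , Δ)
        ∎

  all-holds-NN : ∀ {P} → All (InH ∘ head) P → all (holds f) (NN P) ≡ all (holds f) P
  all-holds-NN heads∈ℋ⁺ = all-holds-concatMap f (All.map (λ {r} → all-holds-Nrule r) heads∈ℋ⁺)

proposition23 : {A : Set} (P : Program A) → P ≢ [] → All NNPRule P →
                StronglyEquivalent (NN₁ P) (NN P)
proposition23 P _ nnp = classicallyEquivalent⇒stronglyEquivalent λ f f-top →
  trans (all-holds-NN₁ f P) (sym (all-holds-NN f f-top (All.map proj₁ nnp)))
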